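{- Let $G=(V,E,(p_e)_{e\in E})$ be a stochastic graph and $K\subseteq V$. For every edge $e_i\in E$ with parameter $p_i$, $$\mathcal{I}_{K}(G)=p_{i}\,x\ \mathcal{I}_{K_{i}}(G\cdot e_{i}) + (1-p_{i})\,\mathcal{I}_{K}(G-e_{i}),$$ as an identity in $\mathbb{R}[x]$, where $K_i=\pi(K)$ is the image of $K$ in $G\cdot e_i$.
   Context: A graph $G=(V,E)$ consists of a finite node set $V$ and a finite set $E$ of edges, each edge being a pair $(\{a,b\},n)$ with $a,b\in V$ (possibly $a=b$) and $n\in\mathbb{N}$, where distinct edges have distinct labels $n$ (so parallel edges and loops are allowed). A stochastic graph $(V,E,(p_e)_{e\in E})$ assigns to each edge an independent Bernoulli random variable with parameter $p_e\in[0,1]$ (edge $e$ is operative with probability $p_e$). A state is a function $\mathcal{E}:E\to\{0,1\}$; its probability is $P(\mathcal{E})=\prod_{e\in E}p_e^{\mathcal{E}(e)}(1-p_e)^{1-\mathcal{E}(e)}$, and $\#\mathcal{E}=\#\mathcal{E}^{ -1}(1)$ is its number of operative edges. Given $K\subseteq V$, a state is a $K$-PathSet if all of $K$ lies in the node set of a single connected component of the graph $(V,\mathcal{E}^{ -1}(1))$ obtained by removing the non-operative edges. Define $\mathcal{I}_K(G)=\sum_{i\ge 0}a_i x^i\in\mathbb{R}[x]$ where $a_i=\sum P(\mathcal{E})$, the sum over all $K$-PathSets $\mathcal{E}$ with $\#\mathcal{E}=i$. For an edge $e=(\{v,w\},n)$: the deletion is $G-e=(V,E\setminus\{e\})$;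 the contraction $G\cdot e$ has node set $V/\!\sim$, where $a\sim b$ iff $a=b$ or $\{a,b\}=\{v,w\}$, with quotient map $\pi$, and edge set $\{(\{\pi(a),\pi(b)\},n) : (\{a,b\},n)\in E\setminus\{e\}\}$. Both $G-e$ and $G\cdot e$ are stochastic graphs with the edge parameters inherited from $G$; the distinguished set in $G-e$ is $K$ and in $G\cdot e$ is $K_e=\pi(K)$. -}

module Defs where

open import Level using (Level)
open import Data.Nat as ℕ using (ℕ; zero; suc)
open import Data.Bool using (Bool; true; false; if_then_else_)
open import Data.Fin as Fin using (Fin; zero; suc; punchIn; punchOut)
open import Data.Fin.Subset using (Subset; _∈_; ⁅_⁆; _∪_; ⊥)
open import Data.Vec using ([]; _∷_)
open import Data.Vec.Functional using () renaming (_∷_ to cons)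
open import Data.Product using (Σ; _×_; _,_; proj₁; proj₂; ∃)
open import Data.Sum using (_⊎_)
open import Relation.Nullary using (Dec; yes; no; ¬_)
open import Relation.Binary.PropositionalEquality using (_≡_; _≢_; sym)
open import Algebra.Bundles using (CommutativeRing)

-- Edges are
-- indexed by Fin m (the index plays the role of the distinct label n
-- of the paper); edge j joins the two endpoints ends j (loops allowed
-- when both coincide, parallel edges allowed).  The order of the two
-- endpoints is irrelevant for everything below (edges are unordered).

record Graph (n m : ℕ) : Set where
  constructor mkGraph
  field
    ends : Fin m → Fin n × Fin n
open Graph public

-- A state: which edges are operative.
State : ℕ → Set
State m = Fin m → Bool

count : ∀ {m} → State m → ℕ
count {zero}  s = 0
count {suc m} s = (if s zero then 1 else 0) ℕ.+ count (λ j → s (suc j))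

data Walk {n m} (G : Graph n m) (s : State m) : Fin n → Fin n → Set where
  here : ∀ {a} → Walk G s a a
  fwd  : ∀ {a c} (j : Fin m) → s j ≡ true → proj₁ (ends G j) ≡ a →
         Walk G s (proj₂ (ends G j)) c → Walk G s a c
  bwd  : ∀ {a c} (j : Fin m) → s j ≡ true → proj₂ (ends G j) ≡ a →
         Walk G s (proj₁ (ends G j)) c → Walk G s a c

Connected : ∀ {n m} → Graph n m → State m → Fin n → Fin n → Set
Connected G s a b = Walk G s a b

PathSet : ∀ {n m} → Graph n m → Subset n → State m → Set
PathSet {n} G K s = Σ (Fin n) λ c → ∀ k → k ∈ K → Connected G s c k

-- A decision procedure for the PathSet predicate (needed to form the
-- indicator in the sum defining the coefficients; any such procedure
-- yields the same indicator).
PathSetDecider : Set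
PathSetDecider = ∀ {n m} (G : Graph n m) (K : Subset n) (s : State m) →
                 Dec (PathSet G K s)

delete : ∀ {n m} → Graph n (suc m) → Fin (suc m) → Graph n m
delete G i = mkGraph (λ j → ends G (punchIn i j))

record Contraction (n m : ℕ) : Set where
  constructor mkContraction
  field
    size  : ℕ
    graph : Graph size m
    π     : Fin n → Fin size
open Contraction public

collapse : ∀ {k} (v w : Fin (suc k)) → v ≢ w → Fin (suc k) → Fin k
collapse v w v≢w a with w Fin.≟ a
... | yes _   = punchOut {i = w} {j = v} (λ w≡v → v≢w (sym w≡v))
... | no w≢a  = punchOut w≢a

quotientOf : ∀ {n} (v w : Fin n) → Σ ℕ λ n' → Fin n → Fin n'
quotientOf {n} v w with v Fin.≟ w
... | yes _ = n , λ a → a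
quotientOf {suc k} v w | no v≢w = k , collapse v w v≢w

contract : ∀ {n m} → Graph n (suc m) → Fin (suc m) → Contraction n m
contract {n} G i =
  mkContraction n' (mkGraph λ j → πq (proj₁ (ends G (punchIn i j))) ,
                                  πq (proj₂ (ends G (punchIn i j)))) πq
  where
  q  = quotientOf (proj₁ (ends G i)) (proj₂ (ends G i))
  n' = proj₁ q
  πq = proj₂ q

image : ∀ {n n'} → (Fin n → Fin n') → Subset n → Subset n'
image {zero}  π []      = ⊥
image {suc n} π (b ∷ K) =
  (if b then ⁅ π zero ⁆ else ⊥) ∪ image (λ a → π (suc a)) K

-- Polynomials over a commutative ring, as coefficient sequences, and the
-- reliability polynomial I_K(G).

module Poly {c ℓ : Level} (R : CommutativeRing c ℓ) where
  open CommutativeRing R using (_≈_; _+_; _*_; _-_; 0#; 1#) renaming (Carrier to A)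

  Polynomial : Set c
  Polynomial = ℕ → A

  _≈ₚ_ : Polynomial → Polynomial → Set ℓ
  f ≈ₚ g = ∀ i → f i ≈ g i

  _+ₚ_ : Polynomial → Polynomial → Polynomial
  (f +ₚ g) i = f i + g i

  _·ₚ_ : A → Polynomial → Polynomial
  (a ·ₚ f) i = a * f i

  X*_ : Polynomial → Polynomial
  (X* f) zero    = 0#
  (X* f) (suc i) = f i

  sumStates : ∀ m → (State m → A) → A
  sumStates zero    f = f (λ ())
  sumStates (suc m) f =
    sumStates m (λ s → f (cons false s)) +
    sumStates m (λ s → f (cons true s))

  prodFin : ∀ m → (Fin m → A) → A
  prodFin zero    f = 1#
  prodFin (suc m) f = f zero * prodFin m (λ j → f (suc j))

  Prob : ∀ {m} → (Fin m → A) → State m → A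
  Prob {m} p s = prodFin m λ j → if s j then p j else (1# - p j)

  indicator : ∀ {ℓ'} {P : Set ℓ'} → Dec P → A
  indicator (yes _) = 1#
  indicator (no _)  = 0#

  reliability : PathSetDecider → ∀ {n m} → Graph n m → (Fin m → A) →
                Subset n → Polynomial
  reliability dec {n} {m} G p K i =
    sumStates m λ s →
      indicator (count s ℕ.≟ i) * (indicator (dec G K s) * Prob p s)

-- Split the sum defining I_K(G) according to the state of e_i.  If e_i is not
-- operative, a state of G is a K-PathSet exactly when its restriction to the
-- other edges is a K-PathSet of G − e_i.  If e_i is operative, exactly when the
-- restriction is a π(K)-PathSet of G · e_i: a walk through e_i projects to a
-- walk in the contraction, and a walk in the contraction lifts by crossing e_i
-- wherever it passes the merged node.  P(state) splits off the factor 1 − p_i,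
-- resp. p_i, and an operative e_i raises the edge count by one, which is the
-- multiplication by x.
module Submission where

open import Defs
open import Level using (Level)
open import Data.Nat using (ℕ; suc)
open import Data.Fin using (Fin; punchIn)
open import Data.Fin.Subset using (Subset)
open import Algebra.Bundles using (CommutativeRing)

open import Data.Nat as ℕ using (zero)
import Data.Nat.Properties as ℕₚ
open import Algebra.Properties.CommutativeSemigroup ℕₚ.+-commutativeSemigroup
  using () renaming (x∙yz≈y∙xz to m+[n+o]≡n+[m+o])
open import Data.Bool using (Bool; true; false; if_then_else_)
open import Data.Fin as Fin using (zero; suc; punchOut)
open import Data.Fin.Properties
  using (punchIn-punchOut; punchOut-punchIn; punchInᵢ≢i; punchOut-cong; punchOut-injective)
open import Data.Fin.Subset using (_∈_; ⁅_⁆; _∪_; ⊥)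
open import Data.Fin.Subset.Properties using (∉⊥; x∈⁅x⁆; x∈⁅y⁆⇒x≡y; x∈p∪q⁻; x∈p∪q⁺)
open import Data.Vec using ([]; _∷_; here; there)
open import Data.Vec.Functional using () renaming (_∷_ to cons)
open import Data.Product using (_×_; _,_; proj₁; proj₂; ∃)
open import Data.Sum using (_⊎_; inj₁; inj₂)
open import Data.Empty using (⊥-elim)
open import Function using (_∘_; _⇔_; mk⇔; Equivalence)
open import Relation.Nullary using (Dec; yes; no)
open import Relation.Binary.PropositionalEquality
  using (_≡_; _≢_; refl; sym; trans; cong; subst)

-- Unlike Data.Vec.Functional.insertAt, this is built from cons, so that
-- insert zero b s is definitionally cons b s and sums over states split
-- at any position without transport along pointwise equality.
insert : ∀ {m} → Fin (suc m) → Bool → State m → State (suc m)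
insert zero    b s = cons b s
insert {suc m} (suc i) b s = cons (s zero) (insert i b (s ∘ suc))

insert-at : ∀ {m} (i : Fin (suc m)) b (s : State m) → insert i b s i ≡ b
insert-at zero    b s = refl
insert-at {suc m} (suc i) b s = insert-at i b (s ∘ suc)

insert-punchIn : ∀ {m} (i : Fin (suc m)) b (s : State m) j →
                 insert i b s (punchIn i j) ≡ s j
insert-punchIn zero    b s j       = refl
insert-punchIn {suc m} (suc i) b s zero    = refl
insert-punchIn {suc m} (suc i) b s (suc j) = insert-punchIn i b (s ∘ suc) j

bit : Bool → ℕ
bit b = if b then 1 else 0

count-insert : ∀ {m} (i : Fin (suc m)) b (s : State m) →
               count (insert i b s) ≡ bit b ℕ.+ count s
count-insert zero    b s = refl
count-insert {suc m} (suc i) b s =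
  trans (cong (bit (s zero) ℕ.+_) (count-insert i b (s ∘ suc)))
        (m+[n+o]≡n+[m+o] (bit (s zero)) (bit b) (count (s ∘ suc)))

data PunchInView {m} (i : Fin (suc m)) : Fin (suc m) → Set where
  at      : PunchInView i i
  punched : (j : Fin m) → PunchInView i (punchIn i j)

punchInView : ∀ {m} (i j : Fin (suc m)) → PunchInView i j
punchInView i j with i Fin.≟ j
... | yes refl = at
... | no i≢j   = subst (PunchInView i) (punchIn-punchOut i≢j) (punched (punchOut i≢j))

_++ʷ_ : ∀ {n m} {G : Graph n m} {s} {a b c} → Walk G s a b → Walk G s b c → Walk G s a c
here            ++ʷ w′ = w′
fwd j on end w  ++ʷ w′ = fwd j on end (w ++ʷ w′)
bwd j on end w  ++ʷ w′ = bwd j on end (w ++ʷ w′)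

module _ {n m} (G : Graph n (suc m)) (i : Fin (suc m)) (s : State m) where

  walk-delete : ∀ {a c} → Walk G (insert i false s) a c → Walk (delete G i) s a c
  walk-delete here = here
  walk-delete (fwd j on end w) with punchInView i j
  ... | at with () ← trans (sym (insert-at i false s)) on
  ... | punched j′ = fwd j′ (trans (sym (insert-punchIn i false s j′)) on) end (walk-delete w)
  walk-delete (bwd j on end w) with punchInView i j
  ... | at with () ← trans (sym (insert-at i false s)) on
  ... | punched j′ = bwd j′ (trans (sym (insert-punchIn i false s j′)) on) end (walk-delete w)

  walk-undelete : ∀ {b a c} → Walk (delete G i) s a c → Walk G (insert i b s) a c
  walk-undelete here = here
  walk-undelete (fwd j on end w) =
    fwd (punchIn i j) (trans (insert-punchIn i _ s j) on) end (walk-undelete w)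
  walk-undelete (bwd j on end w) =
    bwd (punchIn i j) (trans (insert-punchIn i _ s j) on) end (walk-undelete w)

record IsEdgeQuotient {n n′} (v w : Fin n) (f : Fin n → Fin n′) : Set where
  field
    identifies : f v ≡ f w
    fibres     : ∀ {a b} → f a ≡ f b → a ≡ b ⊎ (a ≡ v × b ≡ w) ⊎ (a ≡ w × b ≡ v)
    surjective : ∀ y → ∃ λ a → f a ≡ y

module _ {k} (v w : Fin (suc k)) (v≢w : v ≢ w) where

  private
    w≢v : w ≢ v
    w≢v = v≢w ∘ sym

    collapse-view : ∀ a → (w ≡ a × collapse v w v≢w a ≡ punchOut w≢v)
                        ⊎ ∃ λ (w≢a : w ≢ a) → collapse v w v≢w a ≡ punchOut w≢a
    collapse-view a with w Fin.≟ a
    ... | yes w≡a = inj₁ (w≡a , refl)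
    ... | no  w≢a = inj₂ (w≢a , refl)

  collapse-isEdgeQuotient : IsEdgeQuotient v w (collapse v w v≢w)
  collapse-isEdgeQuotient = record
    { identifies = identifies ; fibres = fibres ; surjective = surjective }
    where
    identifies : collapse v w v≢w v ≡ collapse v w v≢w w
    identifies with collapse-view v | collapse-view w
    ... | inj₁ (w≡v , _) | _              = ⊥-elim (w≢v w≡v)
    ... | _              | inj₂ (w≢w , _) = ⊥-elim (w≢w refl)
    ... | inj₂ (_ , cv)  | inj₁ (_ , cw)  = trans cv (trans (punchOut-cong w refl) (sym cw))

    fibres : ∀ {a b} → collapse v w v≢w a ≡ collapse v w v≢w b →
             a ≡ b ⊎ (a ≡ v × b ≡ w) ⊎ (a ≡ w × b ≡ v)
    fibres {a} {b} ca≡cb with collapse-view a | collapse-view b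
    ... | inj₁ (w≡a , _)  | inj₁ (w≡b , _)  = inj₁ (trans (sym w≡a) w≡b)
    ... | inj₁ (w≡a , ca) | inj₂ (w≢b , cb) =
      inj₂ (inj₂ (sym w≡a , sym (punchOut-injective w≢v w≢b (trans (sym ca) (trans ca≡cb cb)))))
    ... | inj₂ (w≢a , ca) | inj₁ (w≡b , cb) =
      inj₂ (inj₁ (punchOut-injective w≢a w≢v (trans (sym ca) (trans ca≡cb cb)) , sym w≡b))
    ... | inj₂ (w≢a , ca) | inj₂ (w≢b , cb) =
      inj₁ (punchOut-injective w≢a w≢b (trans (sym ca) (trans ca≡cb cb)))

    surjective : ∀ y → ∃ λ a → collapse v w v≢w a ≡ y
    surjective y with collapse-view (punchIn w y)
    ... | inj₁ (w≡wy , _) = ⊥-elim (punchInᵢ≢i w y (sym w≡wy))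
    ... | inj₂ (_ , c)    = punchIn w y , trans c (trans (punchOut-cong w refl) (punchOut-punchIn w))

quotientOf-isEdgeQuotient : ∀ {n} (v w : Fin n) → IsEdgeQuotient v w (proj₂ (quotientOf v w))
quotientOf-isEdgeQuotient {suc k} v w with v Fin.≟ w
... | yes refl = record { identifies = refl ; fibres = inj₁ ; surjective = λ y → y , refl }
... | no v≢w   = collapse-isEdgeQuotient v w v≢w

module _ {n m} (G : Graph n (suc m)) (i : Fin (suc m)) (s : State m) where

  private
    H : Graph (size (contract G i)) m
    H = graph (contract G i)
    f : Fin n → Fin (size (contract G i))
    f = π (contract G i)
    open IsEdgeQuotient (quotientOf-isEdgeQuotient (proj₁ (ends G i)) (proj₂ (ends G i)))

  walk-contract : ∀ {a c} → Walk G (insert i true s) a c → Walk H s (f a) (f c)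
  walk-contract here = here
  walk-contract (fwd j on end w) with punchInView i j
  ... | at = subst (λ x → Walk H s x _) (trans (sym identifies) (cong f end)) (walk-contract w)
  ... | punched j′ =
    fwd j′ (trans (sym (insert-punchIn i true s j′)) on) (cong f end) (walk-contract w)
  walk-contract (bwd j on end w) with punchInView i j
  ... | at = subst (λ x → Walk H s x _) (trans identifies (cong f end)) (walk-contract w)
  ... | punched j′ =
    bwd j′ (trans (sym (insert-punchIn i true s j′)) on) (cong f end) (walk-contract w)

  walk-fibre : ∀ {a b} → f a ≡ f b → Walk G (insert i true s) a b
  walk-fibre fa≡fb with fibres fa≡fb
  ... | inj₁ refl                  = here
  ... | inj₂ (inj₁ (refl , refl)) = fwd i (insert-at i true s) refl here
  ... | inj₂ (inj₂ (refl , refl)) = bwd i (insert-at i true s) refl here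

  walk-uncontract : ∀ {x y} → Walk H s x y →
                    ∀ {a c} → f a ≡ x → f c ≡ y → Walk G (insert i true s) a c
  walk-uncontract here fa fc = walk-fibre (trans fa (sym fc))
  walk-uncontract (fwd j on end w) fa fc =
    walk-fibre (trans fa (sym end)) ++ʷ
    fwd (punchIn i j) (trans (insert-punchIn i true s j) on) refl (walk-uncontract w refl fc)
  walk-uncontract (bwd j on end w) fa fc =
    walk-fibre (trans fa (sym end)) ++ʷ
    bwd (punchIn i j) (trans (insert-punchIn i true s j) on) refl (walk-uncontract w refl fc)

∈-image⁻ : ∀ {n n′} (f : Fin n → Fin n′) K {y} → y ∈ image f K → ∃ λ k → k ∈ K × f k ≡ y
∈-image⁻ {zero}  f []      y∈ = ⊥-elim (∉⊥ y∈)
∈-image⁻ {suc n} f (b ∷ K) y∈ with b | x∈p∪q⁻ (if b then ⁅ f zero ⁆ else ⊥) (image (f ∘ suc) K) y∈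
... | true  | inj₁ y∈⁅f0⁆ = zero , here , sym (x∈⁅y⁆⇒x≡y _ y∈⁅f0⁆)
... | false | inj₁ y∈⊥    = ⊥-elim (∉⊥ y∈⊥)
... | _     | inj₂ y∈rest with ∈-image⁻ (f ∘ suc) K y∈rest
...   | k , k∈K , fk≡y = suc k , there k∈K , fk≡y

∈-image⁺ : ∀ {n n′} (f : Fin n → Fin n′) K {k} → k ∈ K → f k ∈ image f K
∈-image⁺ f (true ∷ K) here =
  x∈p∪q⁺ {p = ⁅ f zero ⁆} {q = image (f ∘ suc) K} (inj₁ (x∈⁅x⁆ _))
∈-image⁺ f (b ∷ K) (there k∈K) =
  x∈p∪q⁺ {p = if b then ⁅ f zero ⁆ else ⊥} {q = image (f ∘ suc) K}
    (inj₂ (∈-image⁺ (f ∘ suc) K k∈K))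

module _ {n m} (G : Graph n (suc m)) (i : Fin (suc m)) (K : Subset n) (s : State m) where

  pathSet-delete : PathSet G K (insert i false s) ⇔ PathSet (delete G i) K s
  pathSet-delete = mk⇔
    (λ (c , walks) → c , λ k k∈K → walk-delete G i s (walks k k∈K))
    (λ (c , walks) → c , λ k k∈K → walk-undelete G i s (walks k k∈K))

  pathSet-contract : PathSet G K (insert i true s) ⇔
                     PathSet (graph (contract G i)) (image (π (contract G i)) K) s
  pathSet-contract = mk⇔ to from
    where
    f : Fin n → Fin (size (contract G i))
    f = π (contract G i)
    open IsEdgeQuotient (quotientOf-isEdgeQuotient (proj₁ (ends G i)) (proj₂ (ends G i)))

    to : PathSet G K (insert i true s) → PathSet (graph (contract G i)) (image f K) s
    to (c , walks) = f c , λ y y∈ →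
      let k , k∈K , fk≡y = ∈-image⁻ f K y∈
      in subst (Walk _ s (f c)) fk≡y (walk-contract G i s (walks k k∈K))

    from : PathSet (graph (contract G i)) (image f K) s → PathSet G K (insert i true s)
    from (c , walks) =
      let a , fa≡c = surjective c
      in a , λ k k∈K → walk-uncontract G i s (walks (f k) (∈-image⁺ f K k∈K)) fa≡c refl

module StateSums {c ℓ : Level} (R : CommutativeRing c ℓ) where
  open CommutativeRing R renaming (Carrier to A; refl to ≈-refl; sym to ≈-sym; trans to ≈-trans)
  open Poly R
  open import Algebra.Properties.CommutativeSemigroup +-commutativeSemigroup
    using () renaming (interchange to +-interchange)
  open import Algebra.Properties.CommutativeSemigroup *-commutativeSemigroup
    using (x∙yz≈y∙xz)

  indicator-cong : ∀ {ℓ₁ ℓ₂} {P : Set ℓ₁} {Q : Set ℓ₂} → P ⇔ Q →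
                   (d : Dec P) (e : Dec Q) → indicator d ≈ indicator e
  indicator-cong P⇔Q (yes _)  (yes _)  = ≈-refl
  indicator-cong P⇔Q (no _)   (no _)   = ≈-refl
  indicator-cong P⇔Q (yes p)  (no ¬q)  = ⊥-elim (¬q (Equivalence.to P⇔Q p))
  indicator-cong P⇔Q (no ¬p)  (yes q)  = ⊥-elim (¬p (Equivalence.from P⇔Q q))

  sumStates-cong : ∀ m {f g : State m → A} → (∀ s → f s ≈ g s) → sumStates m f ≈ sumStates m g
  sumStates-cong zero    f≈g = f≈g _
  sumStates-cong (suc m) f≈g = +-cong (sumStates-cong m (f≈g ∘ _)) (sumStates-cong m (f≈g ∘ _))

  sumStates-*ˡ : ∀ m a (f : State m → A) → sumStates m (λ s → a * f s) ≈ a * sumStates m f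
  sumStates-*ˡ zero    a f = ≈-refl
  sumStates-*ˡ (suc m) a f =
    ≈-trans (+-cong (sumStates-*ˡ m a _) (sumStates-*ˡ m a _)) (≈-sym (distribˡ a _ _))

  sumStates-zero : ∀ m {f : State m → A} → (∀ s → f s ≈ 0#) → sumStates m f ≈ 0#
  sumStates-zero zero    f≈0 = f≈0 _
  sumStates-zero (suc m) f≈0 =
    ≈-trans (+-cong (sumStates-zero m (f≈0 ∘ _)) (sumStates-zero m (f≈0 ∘ _))) (+-identityˡ 0#)

  sumStates-insert : ∀ {m} (i : Fin (suc m)) (f : State (suc m) → A) →
                     sumStates (suc m) f ≈
                     sumStates m (f ∘ insert i false) + sumStates m (f ∘ insert i true)
  sumStates-insert zero    f = ≈-refl
  sumStates-insert {suc m} (suc i) f =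
    ≈-trans (+-cong (sumStates-insert i (f ∘ cons false)) (sumStates-insert i (f ∘ cons true)))
            (+-interchange _ _ _ _)

  sumStates-shift : ∀ m (f : State m → A) k →
    sumStates m (λ s → indicator (suc (count s) ℕ.≟ k) * f s) ≈
    (X* (λ k → sumStates m (λ s → indicator (count s ℕ.≟ k) * f s))) k
  sumStates-shift m f zero    = sumStates-zero m (λ s → zeroˡ (f s))
  sumStates-shift m f (suc k) = sumStates-cong m λ s →
    *-cong (indicator-cong (mk⇔ ℕₚ.suc-injective (cong suc)) (suc (count s) ℕ.≟ suc k) (count s ℕ.≟ k))
           ≈-refl

  edgeFactor : Bool → A → A
  edgeFactor b q = if b then q else 1# - q

  Prob-insert : ∀ {m} (p : Fin (suc m) → A) i b (s : State m) →
                Prob p (insert i b s) ≈ edgeFactor b (p i) * Prob (p ∘ punchIn i) s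
  Prob-insert p zero    b s = ≈-refl
  Prob-insert {suc m} p (suc i) b s =
    ≈-trans (*-cong ≈-refl (Prob-insert (p ∘ suc) i b (s ∘ suc))) (x∙yz≈y∙xz _ _ _)

  weight-insert : ∀ {m} (p : Fin (suc m) → A) i b (s : State m) k
                  {ℓ₁ ℓ₂} {P : Set ℓ₁} {Q : Set ℓ₂} (d : Dec P) (e : Dec Q) → P ⇔ Q →
                  indicator (count (insert i b s) ℕ.≟ k) * (indicator d * Prob p (insert i b s)) ≈
                  edgeFactor b (p i) *
                    (indicator (bit b ℕ.+ count s ℕ.≟ k) * (indicator e * Prob (p ∘ punchIn i) s))
  weight-insert p i b s k d e P⇔Q = ≈-trans
    (*-cong (indicator-cong count≡k (count (insert i b s) ℕ.≟ k) (bit b ℕ.+ count s ℕ.≟ k))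
            (*-cong (indicator-cong P⇔Q d e) (Prob-insert p i b s)))
    (≈-trans (*-cong ≈-refl (x∙yz≈y∙xz _ _ _)) (x∙yz≈y∙xz _ _ _))
    where
    count≡k : (count (insert i b s) ≡ k) ⇔ (bit b ℕ.+ count s ≡ k)
    count≡k = mk⇔ (trans (sym (count-insert i b s))) (trans (count-insert i b s))

mainTheorem1 : {c ℓ : Level} (R : CommutativeRing c ℓ) (dec : PathSetDecider)
    {n m : ℕ} (G : Graph n (suc m)) (p : Fin (suc m) → CommutativeRing.Carrier R)
    (K : Subset n) (i : Fin (suc m)) →
    Poly._≈ₚ_ R (Poly.reliability R dec G p K)
      (Poly._+ₚ_ R
        (Poly._·ₚ_ R (p i)
          (Poly.X*_ R (Poly.reliability R dec (graph (contract G i))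
                         (λ j → p (punchIn i j)) (image (π (contract G i)) K))))
        (Poly._·ₚ_ R (CommutativeRing._-_ R (CommutativeRing.1# R) (p i))
          (Poly.reliability R dec (delete G i) (λ j → p (punchIn i j)) K)))
mainTheorem1 R dec {n} {m} G p K i k = begin
  reliability dec G p K k
    ≈⟨ sumStates-insert i weight ⟩
  sumStates m (weight ∘ insert i false) + sumStates m (weight ∘ insert i true)
    ≈⟨ +-cong inoperative operative ⟩
  (1# - p i) * reliability dec G⁻ p′ K k + p i * (X* reliability dec G· p′ K·) k
    ≈⟨ +-comm _ _ ⟩
  p i * (X* reliability dec G· p′ K·) k + (1# - p i) * reliability dec G⁻ p′ K k ∎
  where
  open CommutativeRing R renaming (Carrier to A; refl to ≈-refl; trans to ≈-trans)
  open Poly R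
  open StateSums R
  open import Relation.Binary.Reasoning.Setoid setoid

  p′ : Fin m → A
  p′ = p ∘ punchIn i
  G⁻ : Graph n m
  G⁻ = delete G i
  G· : Graph (size (contract G i)) m
  G· = graph (contract G i)
  K· : Subset (size (contract G i))
  K· = image (π (contract G i)) K

  weight : State (suc m) → A
  weight s = indicator (count s ℕ.≟ k) * (indicator (dec G K s) * Prob p s)

  inoperative : sumStates m (weight ∘ insert i false) ≈ (1# - p i) * reliability dec G⁻ p′ K k
  inoperative = ≈-trans
    (sumStates-cong m λ s →
      weight-insert p i false s k (dec G K _) (dec G⁻ K s) (pathSet-delete G i K s))
    (sumStates-*ˡ m _ _)

  operative : sumStates m (weight ∘ insert i true) ≈ p i * (X* reliability dec G· p′ K·) k
  operative = ≈-trans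
    (sumStates-cong m λ s →
      weight-insert p i true s k (dec G K _) (dec G· K· s) (pathSet-contract G i K s))
    (≈-trans (sumStates-*ˡ m _ _) (*-cong ≈-refl (sumStates-shift m _ k)))
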